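{- Let $S$ be a divergence $\omega$-algebra and let $\top=1^\omega$. Then: (1) $\mathrm{dom}(a^\omega)\le\nabla a$ for all $a\in S$; (2) if $a\top=(\mathrm{dom}\,a)\top$ for all $a\in S$, then $\nabla a\le\mathrm{dom}(a^\omega)$ for all $a\in S$.
   Context: An idempotent semiring is a structure $(S,+,\cdot,0,1)$ such that $(S,+,0)$ is a commutative monoid with $a+a=a$, $(S,\cdot,1)$ is a monoid, multiplication distributes over addition from both sides, and $0a=a0=0$; natural order $a\le b\iff a+b=b$. A test is an element $p\le 1$ for which some $q$ satisfies $p+q=1$ and $pq=0=qp$; $q$ is unique, written $\neg p$; tests form a Boolean algebra $\mathrm{test}(S)$. $S$ is a modal semiring if for each $a\in S$ there are maps $|a\rangle,\langle a|$ on $\mathrm{test}(S)$ with, for all $a,b,p,q$: $|a\rangle p\le q\iff \neg q\,a\,p\le 0$; $\langle a|p\le q\iff p\,a\,\neg q\le 0$; $|ab\rangle p=|a\rangle(|b\rangle p)$; $\langle ab|p=\langle b|(\langle a|p)$. Domain: $\mathrm{dom}\,a=|a\rangle 1$. A Kleene algebra is an idempotent semiring with ${}^*$ such that $1+aa^*\le a^*$, $b+ac\le c\Rightarrow a^*b\le c$, $1+a^*a\le a^*$, $b+ca\le c\Rightarrow ba^*\le c$. An $\omega$-algebra is a Kleene algebra with ${}^\omega$ such that $a^\omega\le aa^\omega$ and $c\le ac+b\Rightarrow c\le a^\omega+a^*b$. A test $\nabla a$ is the divergence of $a$ if $\nabla a\le|a\rangle\nabla a$ and for every test $p$, $p\le|a\rangle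 p\Rightarrow p\le\nabla a$. A divergence $\omega$-algebra is an $\omega$-algebra that is a modal semiring in which $\nabla a$ exists for all $a$. -}

module Defs where

open import Data.Product using (Σ; _×_; _,_; proj₁; proj₂)
open import Function.Bundles using (_⇔_)
open import Relation.Binary.PropositionalEquality using (_≡_)

record DivergenceOmegaAlgebra : Set₁ where
  infixl 6 _+_
  infixl 7 _·_
  infix 4 _≤_
  field
    Carrier : Set
    _+_ : Carrier → Carrier → Carrier
    _·_ : Carrier → Carrier → Carrier
    0# : Carrier
    1# : Carrier
    +-assoc : ∀ a b c → (a + b) + c ≡ a + (b + c)
    +-comm : ∀ a b → a + b ≡ b + a
    +-identityˡ : ∀ a → 0# + a ≡ a
    +-idem : ∀ a → a + a ≡ a
    ·-assoc : ∀ a b c → (a · b) · c ≡ a · (b · c)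
    ·-identityˡ : ∀ a → 1# · a ≡ a
    ·-identityʳ : ∀ a → a · 1# ≡ a
    distribˡ : ∀ a b c → a · (b + c) ≡ a · b + a · c
    distribʳ : ∀ a b c → (b + c) · a ≡ b · a + c · a
    zeroˡ : ∀ a → 0# · a ≡ 0#
    zeroʳ : ∀ a → a · 0# ≡ 0#

  _≤_ : Carrier → Carrier → Set
  a ≤ b = a + b ≡ b

  -- tests: p ≤ 1 with a complement q (unique; carried as witness)
  IsTest : Carrier → Set
  IsTest p = p ≤ 1# × Σ Carrier (λ q → (p + q ≡ 1#) × (p · q ≡ 0#) × (q · p ≡ 0#))

  Test : Set
  Test = Σ Carrier IsTest

  ⌜_⌝ : Test → Carrier
  ⌜ p ⌝ = proj₁ p

  neg : Test → Carrier
  neg p = proj₁ (proj₂ (proj₂ p))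

  field
    fdia : Carrier → Test → Test
    bdia : Carrier → Test → Test
    fdia-adj : ∀ a (p q : Test) → (⌜ fdia a p ⌝ ≤ ⌜ q ⌝) ⇔ (neg q · a · ⌜ p ⌝ ≤ 0#)
    bdia-adj : ∀ a (p q : Test) → (⌜ bdia a p ⌝ ≤ ⌜ q ⌝) ⇔ (⌜ p ⌝ · a · neg q ≤ 0#)
    fdia-· : ∀ a b (p : Test) → ⌜ fdia (a · b) p ⌝ ≡ ⌜ fdia a (fdia b p) ⌝
    bdia-· : ∀ a b (p : Test) → ⌜ bdia (a · b) p ⌝ ≡ ⌜ bdia b (bdia a p) ⌝
    _⋆ : Carrier → Carrier
    ⋆-unfoldˡ : ∀ a → 1# + a · (a ⋆) ≤ a ⋆
    ⋆-inductˡ : ∀ a b c → b + a · c ≤ c → (a ⋆) · b ≤ c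
    ⋆-unfoldʳ : ∀ a → 1# + (a ⋆) · a ≤ a ⋆
    ⋆-inductʳ : ∀ a b c → b + c · a ≤ c → b · (a ⋆) ≤ c
    _^ω : Carrier → Carrier
    ω-unfold : ∀ a → a ^ω ≤ a · (a ^ω)
    ω-coinduct : ∀ a b c → c ≤ a · c + b → c ≤ a ^ω + (a ⋆) · b
    ∇ : Carrier → Test
    ∇-unfold : ∀ a → ⌜ ∇ a ⌝ ≤ ⌜ fdia a (∇ a) ⌝
    ∇-greatest : ∀ a (p : Test) → ⌜ p ⌝ ≤ ⌜ fdia a p ⌝ → ⌜ p ⌝ ≤ ⌜ ∇ a ⌝

  1-test : Test
  1-test = 1# , +-idem 1# , 0# , (≡-trans' (+-comm 1# 0#) (+-identityˡ 1#)) , zeroʳ 1# , zeroˡ 1#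
    where
      ≡-trans' : ∀ {x y z : Carrier} → x ≡ y → y ≡ z → x ≡ z
      ≡-trans' _≡_.refl q = q

  dom : Carrier → Carrier
  dom a = ⌜ fdia a 1-test ⌝

  ⊤ : Carrier
  ⊤ = 1# ^ω

-- Proof idea.  (1) The test dom (a^ω) is a fixed point candidate for
-- divergence: unfolding a^ω ≤ a·a^ω and distributing the forward diamond
-- over the product gives dom (a^ω) ≤ |a⟩ dom (a^ω), so it lies below the
-- greatest such test ∇a.  (2) Put p = ∇a.  Then p ≤ |a⟩p ≤ dom (a·p), so
-- under the hypothesis p·⊤ ≤ dom (a·p)·⊤ = a·(p·⊤); coinduction for ω
-- yields p·⊤ ≤ a^ω, hence p ≤ p·⊤ ≤ a^ω (as 1 ≤ ⊤), and a test below x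
-- lies below dom x.
module Submission where

open import Defs
open import Data.Product using (_×_; _,_; proj₁; proj₂)
open import Function.Bundles using (Equivalence)
open import Relation.Binary.Bundles using (Poset)
open import Relation.Binary.PropositionalEquality
  using (_≡_; refl; sym; trans; cong; isEquivalence)
import Relation.Binary.Reasoning.PartialOrder as PosetReasoning

module Development (S : DivergenceOmegaAlgebra) where
  open DivergenceOmegaAlgebra S

  ≤-refl : ∀ x → x ≤ x
  ≤-refl = +-idem

  ≡⇒≤ : ∀ {x y} → x ≡ y → x ≤ y
  ≡⇒≤ {x} refl = ≤-refl x

  ≤-trans : ∀ {x y z} → x ≤ y → y ≤ z → x ≤ z
  ≤-trans {x} {y} {z} x≤y y≤z = begin
    x + z        ≡⟨ cong (x +_) (sym y≤z) ⟩
    x + (y + z)  ≡⟨ sym (+-assoc x y z) ⟩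
    (x + y) + z  ≡⟨ cong (_+ z) x≤y ⟩
    y + z        ≡⟨ y≤z ⟩
    z            ∎
    where open Relation.Binary.PropositionalEquality.≡-Reasoning

  ≤-antisym : ∀ {x y} → x ≤ y → y ≤ x → x ≡ y
  ≤-antisym {x} {y} x≤y y≤x = trans (sym y≤x) (trans (+-comm y x) x≤y)

  ≤-poset : Poset _ _ _
  ≤-poset = record
    { Carrier = Carrier ; _≈_ = _≡_ ; _≤_ = _≤_
    ; isPartialOrder = record
      { isPreorder = record
        { isEquivalence = isEquivalence ; reflexive = ≡⇒≤ ; trans = ≤-trans }
      ; antisym = ≤-antisym } }

  open PosetReasoning ≤-poset

  +-identityʳ : ∀ x → x + 0# ≡ x
  +-identityʳ x = trans (+-comm x 0#) (+-identityˡ x)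

  ≤0⇒≡0 : ∀ {x} → x ≤ 0# → x ≡ 0#
  ≤0⇒≡0 {x} x≤0 = trans (sym (+-identityʳ x)) x≤0

  ·-monoˡ : ∀ c {a b} → a ≤ b → c · a ≤ c · b
  ·-monoˡ c {a} {b} a≤b = trans (sym (distribˡ c a b)) (cong (c ·_) a≤b)

  ·-monoʳ : ∀ c {a b} → a ≤ b → a · c ≤ b · c
  ·-monoʳ c {a} {b} a≤b = trans (sym (distribʳ c a b)) (cong (_· c) a≤b)

  test-≤1 : (p : Test) → ⌜ p ⌝ ≤ 1#
  test-≤1 p = proj₁ (proj₂ p)

  test-split : (p : Test) → ⌜ p ⌝ + neg p ≡ 1#
  test-split p = proj₁ (proj₂ (proj₂ (proj₂ p)))

  annihilated⇒≤ : (p d : Test) → neg d · ⌜ p ⌝ ≡ 0# → ⌜ p ⌝ ≤ ⌜ d ⌝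
  annihilated⇒≤ p d ¬d·p≡0 = begin
    P                    ≡⟨ sym (·-identityˡ P) ⟩
    1# · P               ≡⟨ cong (_· P) (sym (test-split d)) ⟩
    (D + neg d) · P      ≡⟨ distribʳ P D (neg d) ⟩
    D · P + neg d · P    ≡⟨ cong (D · P +_) ¬d·p≡0 ⟩
    D · P + 0#           ≡⟨ +-identityʳ (D · P) ⟩
    D · P                ≤⟨ ·-monoˡ D (test-≤1 p) ⟩
    D · 1#               ≡⟨ ·-identityʳ D ⟩
    D                    ∎
    where
      P = ⌜ p ⌝
      D = ⌜ d ⌝

  fdia-annihilates : ∀ a (p : Test) → neg (fdia a p) · a · ⌜ p ⌝ ≡ 0#
  fdia-annihilates a p =
    ≤0⇒≡0 (Equivalence.to (fdia-adj a p (fdia a p)) (≤-refl ⌜ fdia a p ⌝))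

  domT : Carrier → Test
  domT x = fdia x 1-test

  neg-dom-annihilates : ∀ x → neg (domT x) · x ≡ 0#
  neg-dom-annihilates x =
    trans (sym (·-identityʳ _)) (fdia-annihilates x 1-test)

  test≤⇒≤dom : (p : Test) (x : Carrier) → ⌜ p ⌝ ≤ x → ⌜ p ⌝ ≤ dom x
  test≤⇒≤dom p x p≤x = annihilated⇒≤ p (domT x) (≤0⇒≡0 (begin
    neg (domT x) · ⌜ p ⌝  ≤⟨ ·-monoˡ (neg (domT x)) p≤x ⟩
    neg (domT x) · x      ≡⟨ neg-dom-annihilates x ⟩
    0#                    ∎))

  fdia-mono : ∀ {a b} (p : Test) → a ≤ b → ⌜ fdia a p ⌝ ≤ ⌜ fdia b p ⌝
  fdia-mono {a} {b} p a≤b = Equivalence.from (fdia-adj a p (fdia b p)) (begin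
    neg (fdia b p) · a · ⌜ p ⌝  ≤⟨ ·-monoʳ ⌜ p ⌝ (·-monoˡ (neg (fdia b p)) a≤b) ⟩
    neg (fdia b p) · b · ⌜ p ⌝  ≡⟨ fdia-annihilates b p ⟩
    0#                          ∎)

  fdia≤dom : ∀ a (p : Test) → ⌜ fdia a p ⌝ ≤ dom (a · ⌜ p ⌝)
  fdia≤dom a p = Equivalence.from (fdia-adj a p (domT (a · ⌜ p ⌝))) (begin
    neg (domT (a · P)) · a · P    ≡⟨ ·-assoc (neg (domT (a · P))) a P ⟩
    neg (domT (a · P)) · (a · P)  ≡⟨ neg-dom-annihilates (a · P) ⟩
    0#                            ∎)
    where P = ⌜ p ⌝

  ω-coinduct₀ : ∀ a c → c ≤ a · c → c ≤ a ^ω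
  ω-coinduct₀ a c c≤ac = begin
    c                   ≤⟨ ω-coinduct a 0# c (begin
                             c            ≤⟨ c≤ac ⟩
                             a · c        ≡⟨ sym (+-identityʳ (a · c)) ⟩
                             a · c + 0#   ∎) ⟩
    a ^ω + (a ⋆) · 0#   ≡⟨ cong (a ^ω +_) (zeroʳ (a ⋆)) ⟩
    a ^ω + 0#           ≡⟨ +-identityʳ (a ^ω) ⟩
    a ^ω                ∎

  1≤⊤ : 1# ≤ ⊤
  1≤⊤ = ω-coinduct₀ 1# 1# (≡⇒≤ (sym (·-identityˡ 1#)))

  ≤·⊤ : ∀ x → x ≤ x · ⊤
  ≤·⊤ x = begin
    x       ≡⟨ sym (·-identityʳ x) ⟩
    x · 1#  ≤⟨ ·-monoˡ x 1≤⊤ ⟩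
    x · ⊤   ∎

  dom-ω≤∇ : ∀ a → dom (a ^ω) ≤ ⌜ ∇ a ⌝
  dom-ω≤∇ a = ∇-greatest a (domT (a ^ω)) (begin
    dom (a ^ω)                       ≤⟨ fdia-mono 1-test (ω-unfold a) ⟩
    dom (a · a ^ω)                   ≡⟨ fdia-· a (a ^ω) 1-test ⟩
    ⌜ fdia a (domT (a ^ω)) ⌝         ∎)

  -- Under a·⊤ = dom a · ⊤, the test ∇a·⊤ is a-expansive, hence below a^ω.
  ∇≤dom-ω : (∀ a → a · ⊤ ≡ dom a · ⊤) → ∀ a → ⌜ ∇ a ⌝ ≤ dom (a ^ω)
  ∇≤dom-ω top-dom a = test≤⇒≤dom (∇ a) (a ^ω) (begin
    P       ≤⟨ ≤·⊤ P ⟩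
    P · ⊤   ≤⟨ ω-coinduct₀ a (P · ⊤) P⊤-expansive ⟩
    a ^ω    ∎)
    where
      P = ⌜ ∇ a ⌝
      P⊤-expansive : P · ⊤ ≤ a · (P · ⊤)
      P⊤-expansive = begin
        P · ⊤              ≤⟨ ·-monoʳ ⊤ (≤-trans (∇-unfold a) (fdia≤dom a (∇ a))) ⟩
        dom (a · P) · ⊤    ≡⟨ sym (top-dom (a · P)) ⟩
        (a · P) · ⊤        ≡⟨ ·-assoc a P ⊤ ⟩
        a · (P · ⊤)        ∎

lemma7p7 : (S : DivergenceOmegaAlgebra) → let open DivergenceOmegaAlgebra S in
    (∀ a → dom (a ^ω) ≤ ⌜ ∇ a ⌝)
    × ((∀ a → a · ⊤ ≡ dom a · ⊤) → ∀ a → ⌜ ∇ a ⌝ ≤ dom (a ^ω))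
lemma7p7 S = dom-ω≤∇ , ∇≤dom-ω
  where open Development S
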